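{- Let $G$, the labelling of $C$, the sets $A,B$, and the words $p_1,p_2,p_3$ be as in the context. For every $a \in A$, the word $m_a\, a\, n_a$ is a subword (subsequence) of each of $p_1$, $p_2$ and $p_3$.
   Context: Let $G=(I\cup C,E)$ be a split graph, $I$ independent, $C$ a clique, with $C$ inclusion-wise maximal (no vertex of $I$ is adjacent to all of $C$). For integers $x\le y$ write $[x,y]=\{x,x+1,\dots,y\}$. Assume the vertices of $C$ are labelled $1,\dots,k$ ($k=|C|$) so that for all $a,b\in I$: (i) either $N(a)=[1,m]\cup[n,k]$ for some $m<n$, or $N(a)=[l,r]$ for some $l\le r$; (ii) if $N(a)=[1,m]\cup[n,k]$ ($m<n$) and $N(b)=[l,r]$ ($l\le r$) then $l>m$ or $r<n$; (iii) if $N(a)=[1,m]\cup[n,k]$ and $N(b)=[1,m']\cup[n',k]$ ($m<n$, $m'<n'$) then $m'<n$ and $m<n'$. Let $A$ be the set of $a\in I$ whose neighbourhood is of the form $[1,m_a]\cup[n_a,k]$ with $1\le m_a$, $m_a+1<n_a\le k$ (not an interval), and $B$ the set of $a\in I$ with $N(a)=[l_a,r_a]$, $l_a\le r_a$; then $I=A\cup B$ disjointly. Construction (Algorithm 1): initialise $p_1=p_2=p_3=12\cdots k$ and $d=1$. For each $a\in I$ in turn: if $a\in A$ with $N(a)=[1,m]\cup[n,k]$, set $d:=m$ if $m>d$, replace the letter $m$ in $p_1$ by $ma$ (insert $a$ immediately after $m$), and replace the letter $n$ in $p_2$ by $an$ (insert $a$ immediately before $n$); if $a\in B$ with $N(a)=[l,r]$,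 replace $l$ in $p_1$ by $al$ and $r$ in $p_2$ by $ra$. After processing all of $I$, replace the letter $d$ in $p_3$ by $d\,(p_1|_A)^R$, where $p_1|_A$ is the subsequence of $p_1$ of letters in $A$ and $^R$ denotes reversal. The output is $w=p_1\,(p_1|_B)^R\,p_2\,p_3$. -}

module Defs where

open import Data.Nat using (ℕ; zero; suc; _+_; _≤_; _<_; _⊔_; _≡ᵇ_)
open import Data.Bool using (Bool; true; false; if_then_else_)
open import Data.List using (List; []; _∷_; _++_; reverse; foldl; applyUpTo)
open import Data.Product using (_×_)
open import Data.Sum using (_⊎_)
open import Relation.Nullary using (¬_)
open import Relation.Binary.PropositionalEquality using (_≡_)

-- Letters of the words: clique vertices (labelled by naturals 1..k)
-- and independent-set vertices (named by naturals).
data Letter : Set where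
  cl : ℕ → Letter
  iv : ℕ → Letter

-- Neighbourhood of a vertex of I, as in condition (i):
--   wrap m n  stands for  [1,m] ∪ [n,k]
--   intv l r  stands for  [l,r]
data Nbhd : Set where
  wrap : ℕ → ℕ → Nbhd
  intv : ℕ → ℕ → Nbhd

-- Membership of a clique vertex c in the neighbourhood (the edges of G
-- between I and C).
_∈N[_]_ : ℕ → ℕ → Nbhd → Set
c ∈N[ k ] wrap m n = (1 ≤ c × c ≤ m) ⊎ (n ≤ c × c ≤ k)
c ∈N[ k ] intv l r = l ≤ c × c ≤ r

-- Admissible neighbourhoods: a ∈ A  (1 ≤ m, m+1 < n ≤ k)  or  a ∈ B
-- (1 ≤ l ≤ r ≤ k), together with maximality of C (no vertex of I is
-- adjacent to all of 1..k; automatic for the A-form).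
WellFormed : ℕ → Nbhd → Set
WellFormed k (wrap m n) = 1 ≤ m × suc m < n × n ≤ k
WellFormed k (intv l r) = 1 ≤ l × l ≤ r × r ≤ k × ¬ (l ≡ 1 × r ≡ k)

base : ℕ → List Letter
base k = applyUpTo (λ i → cl (suc i)) k

afterCl : ℕ → List Letter → List Letter → List Letter
afterCl c w [] = []
afterCl c w (cl x ∷ xs) =
  (if x ≡ᵇ c then cl x ∷ w else cl x ∷ []) ++ afterCl c w xs
afterCl c w (iv x ∷ xs) = iv x ∷ afterCl c w xs

beforeCl : ℕ → List Letter → List Letter → List Letter
beforeCl c w [] = []
beforeCl c w (cl x ∷ xs) =
  (if x ≡ᵇ c then w ++ (cl x ∷ []) else cl x ∷ []) ++ beforeCl c w xs
beforeCl c w (iv x ∷ xs) = iv x ∷ beforeCl c w xs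

record State : Set where
  constructor st
  field
    p1 : List Letter
    p2 : List Letter
    d  : ℕ
open State public

step : (ℕ → Nbhd) → State → ℕ → State
step N s a with N a
... | wrap m n = st (afterCl m (iv a ∷ []) (p1 s)) (beforeCl n (iv a ∷ []) (p2 s)) (d s ⊔ m)
... | intv l r = st (beforeCl l (iv a ∷ []) (p1 s)) (afterCl r (iv a ∷ []) (p2 s)) (d s)

run : ℕ → (ℕ → Nbhd) → List ℕ → State
run k N I = foldl (step N) (st (base k) (base k) 1) I

isA : (ℕ → Nbhd) → ℕ → Bool
isA N a with N a
... | wrap _ _ = true
... | intv _ _ = false

restrictA : (ℕ → Nbhd) → List Letter → List Letter
restrictA N [] = []
restrictA N (cl x ∷ xs) = restrictA N xs
restrictA N (iv a ∷ xs) = if isA N a then iv a ∷ restrictA N xs else restrictA N xs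

restrictB : (ℕ → Nbhd) → List Letter → List Letter
restrictB N [] = []
restrictB N (cl x ∷ xs) = restrictB N xs
restrictB N (iv a ∷ xs) = if isA N a then restrictB N xs else iv a ∷ restrictB N xs

P1 : ℕ → (ℕ → Nbhd) → List ℕ → List Letter
P1 k N I = p1 (run k N I)

P2 : ℕ → (ℕ → Nbhd) → List ℕ → List Letter
P2 k N I = p2 (run k N I)

P3 : ℕ → (ℕ → Nbhd) → List ℕ → List Letter
P3 k N I = afterCl (d (run k N I)) (reverse (restrictA N (P1 k N I))) (base k)

W : ℕ → (ℕ → Nbhd) → List ℕ → List Letter
W k N I = P1 k N I ++ reverse (restrictB N (P1 k N I)) ++ P2 k N I ++ P3 k N I

-- The loop only ever inserts letters, so p₁ and p₂ only grow; when a ∈ A is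
-- processed it is inserted right after m_a in p₁ and right before n_a in p₂,
-- between the two clique letters m_a < n_a, and stays there. In p₃ the whole
-- word (p₁|_A)^R, which contains a, is inserted after d, and condition (iii)
-- gives m_a ≤ d < n_a since d is the largest m_b seen.
module Submission where

open import Defs
open import Data.Nat using (ℕ; _<_)
open import Data.List using (List; []; _∷_)
open import Data.List.Membership.Propositional using (_∈_)
open import Data.List.Relation.Unary.Unique.Propositional using (Unique)
open import Data.List.Relation.Binary.Sublist.Propositional using (_⊆_)
open import Data.Product using (_×_)
open import Data.Sum using (_⊎_)
open import Relation.Binary.PropositionalEquality using (_≡_)

open import Data.Nat using (suc; _≤_; _⊔_; _≡ᵇ_; z≤n; s≤s)
open import Data.Nat.Properties
  using (_≟_; ≤-refl; ≤-trans; <-trans; n<1+n; m≤m⊔n; m≤n⊔m; ⊔-lub; <⇒≢; >⇒≢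
        ; m≤n⇒m<n∨m≡n)
open import Data.Bool using (true; false; if_then_else_)
open import Data.List using (_++_; [_]; reverse; foldl; applyUpTo; concatMap)
open import Data.List.Properties using (applyUpTo-∷ʳ; ++-identityʳ)
open import Data.List.Relation.Unary.Any using (here; there)
open import Data.List.Relation.Unary.Any.Properties using (reverse⁺)
open import Data.List.Relation.Binary.Sublist.Propositional
  using ([]; _∷_; _∷ʳ_; minimum; ⊆-refl; ⊆-trans; ⊆-reflexive; from∈; to∈)
open import Data.List.Relation.Binary.Sublist.Propositional.Properties
  using (++⁺; ++⁺ˡ; ∷ˡ⁻; module ⊆-Reasoning)
open import Data.Product using (_,_; proj₁)
open import Data.Sum using (inj₁; inj₂)
open import Data.Unit using (⊤; tt)
open import Function using (_∘_)
open import Relation.Binary.PropositionalEquality using (refl; sym; cong; subst; _≗_; _≢_)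
open import Relation.Nullary.Decidable using (dec-true; dec-false)

private
  variable
    A S X : Set

concatMap⁺ : (σ : A → List A) {xs ys : List A} → xs ⊆ ys → concatMap σ xs ⊆ concatMap σ ys
concatMap⁺ σ []        = []
concatMap⁺ σ (y ∷ʳ τ)  = ++⁺ˡ (σ y) (concatMap⁺ σ τ)
concatMap⁺ σ (refl ∷ τ) = ++⁺ ⊆-refl (concatMap⁺ σ τ)

concatMap-inflationary : (σ : A → List A) → (∀ x → [ x ] ⊆ σ x) →
                         (xs : List A) → xs ⊆ concatMap σ xs
concatMap-inflationary σ x⊆σx []       = []
concatMap-inflationary σ x⊆σx (x ∷ xs) = ++⁺ (x⊆σx x) (concatMap-inflationary σ x⊆σx xs)

applyUpTo⁺ : (f : ℕ → A) {j k : ℕ} → j ≤ k → applyUpTo f j ⊆ applyUpTo f k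
applyUpTo⁺ f {k = k} z≤n = minimum (applyUpTo f k)
applyUpTo⁺ f (s≤s j≤k) = refl ∷ applyUpTo⁺ (f ∘ suc) j≤k

snoc⊆applyUpTo : (f : ℕ → A) {xs : List A} {j k : ℕ} →
                 xs ⊆ applyUpTo f j → j < k → xs ++ [ f j ] ⊆ applyUpTo f k
snoc⊆applyUpTo f {xs} {j} τ j<k =
  ⊆-trans (subst (xs ++ [ f j ] ⊆_) (applyUpTo-∷ʳ f j) (++⁺ τ ⊆-refl)) (applyUpTo⁺ f j<k)

Preserves : (S → X → S) → (S → Set) → Set
Preserves f P = ∀ {s} y → P s → P (f s y)

foldl-preserves : (f : S → X → S) (P : S → Set) {s : S} (xs : List X) →
                  (∀ {t} y → y ∈ xs → P t → P (f t y)) → P s → P (foldl f s xs)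
foldl-preserves f P []       pres Ps = Ps
foldl-preserves f P (x ∷ xs) pres Ps =
  foldl-preserves f P xs (λ y y∈xs → pres y (there y∈xs)) (pres x (here refl) Ps)

foldl-establishes : (f : S → X → S) (P Q : S → Set) {x : X} {s : S} (xs : List X) →
                    Preserves f P → Preserves f Q → (∀ {t} → P t → Q (f t x)) →
                    x ∈ xs → P s → Q (foldl f s xs)
foldl-establishes f P Q (_ ∷ xs) presP presQ establish (here refl) Ps =
  foldl-preserves f Q xs (λ y _ → presQ y) (establish Ps)
foldl-establishes f P Q (y ∷ xs) presP presQ establish (there x∈xs) Ps =
  foldl-establishes f P Q xs presP presQ establish x∈xs (presP y Ps)

≡ᵇ-refl : (c : ℕ) → (c ≡ᵇ c) ≡ true
≡ᵇ-refl c = dec-true (c ≟ c) refl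

≢⇒≡ᵇ-false : {x c : ℕ} → x ≢ c → (x ≡ᵇ c) ≡ false
≢⇒≡ᵇ-false {x} {c} = dec-false (x ≟ c)

insertAfter : ℕ → List Letter → Letter → List Letter
insertAfter c w (cl x) = if x ≡ᵇ c then cl x ∷ w else [ cl x ]
insertAfter c w (iv x) = [ iv x ]

insertBefore : ℕ → List Letter → Letter → List Letter
insertBefore c w (cl x) = if x ≡ᵇ c then w ++ [ cl x ] else [ cl x ]
insertBefore c w (iv x) = [ iv x ]

afterCl-concatMap : (c : ℕ) (w : List Letter) →
                    afterCl c w ≗ concatMap (insertAfter c w)
afterCl-concatMap c w []          = refl
afterCl-concatMap c w (cl x ∷ xs) = cong (insertAfter c w (cl x) ++_) (afterCl-concatMap c w xs)
afterCl-concatMap c w (iv x ∷ xs) = cong (iv x ∷_) (afterCl-concatMap c w xs)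

beforeCl-concatMap : (c : ℕ) (w : List Letter) →
                     beforeCl c w ≗ concatMap (insertBefore c w)
beforeCl-concatMap c w []          = refl
beforeCl-concatMap c w (cl x ∷ xs) = cong (insertBefore c w (cl x) ++_) (beforeCl-concatMap c w xs)
beforeCl-concatMap c w (iv x ∷ xs) = cong (iv x ∷_) (beforeCl-concatMap c w xs)

insertAfter-inflationary : (c : ℕ) (w : List Letter) (x : Letter) → [ x ] ⊆ insertAfter c w x
insertAfter-inflationary c w (cl x) with x ≡ᵇ c
... | true  = refl ∷ minimum w
... | false = ⊆-refl
insertAfter-inflationary c w (iv x) = ⊆-refl

insertBefore-inflationary : (c : ℕ) (w : List Letter) (x : Letter) → [ x ] ⊆ insertBefore c w x
insertBefore-inflationary c w (cl x) with x ≡ᵇ c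
... | true  = ++⁺ˡ w ⊆-refl
... | false = ⊆-refl
insertBefore-inflationary c w (iv x) = ⊆-refl

afterCl-inflationary : (c : ℕ) (w xs : List Letter) → xs ⊆ afterCl c w xs
afterCl-inflationary c w xs =
  subst (xs ⊆_) (sym (afterCl-concatMap c w xs))
        (concatMap-inflationary _ (insertAfter-inflationary c w) xs)

beforeCl-inflationary : (c : ℕ) (w xs : List Letter) → xs ⊆ beforeCl c w xs
beforeCl-inflationary c w xs =
  subst (xs ⊆_) (sym (beforeCl-concatMap c w xs))
        (concatMap-inflationary _ (insertBefore-inflationary c w) xs)

afterCl⁺ : (c : ℕ) (w : List Letter) {xs ys : List Letter} →
           xs ⊆ ys → afterCl c w xs ⊆ afterCl c w ys
afterCl⁺ c w {xs} {ys} τ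
  rewrite afterCl-concatMap c w xs | afterCl-concatMap c w ys = concatMap⁺ _ τ

beforeCl⁺ : (c : ℕ) (w : List Letter) {xs ys : List Letter} →
            xs ⊆ ys → beforeCl c w xs ⊆ beforeCl c w ys
beforeCl⁺ c w {xs} {ys} τ
  rewrite beforeCl-concatMap c w xs | beforeCl-concatMap c w ys = concatMap⁺ _ τ

afterCl-skip : {c x : ℕ} (w xs : List Letter) → x ≢ c →
               afterCl c w (cl x ∷ xs) ≡ cl x ∷ afterCl c w xs
afterCl-skip w xs x≢c rewrite ≢⇒≡ᵇ-false x≢c = refl

afterCl-pair : {m n : ℕ} (w : List Letter) → m < n →
               afterCl m w (cl m ∷ cl n ∷ []) ≡ cl m ∷ w ++ [ cl n ]
afterCl-pair {m} w m<n rewrite ≡ᵇ-refl m | ≢⇒≡ᵇ-false (>⇒≢ m<n) = refl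

beforeCl-pair : {m n : ℕ} (w : List Letter) → m < n →
                beforeCl n w (cl m ∷ cl n ∷ []) ≡ cl m ∷ w ++ [ cl n ]
beforeCl-pair {m} {n} w m<n rewrite ≡ᵇ-refl n | ≢⇒≡ᵇ-false (<⇒≢ m<n) =
  cong (cl m ∷_) (++-identityʳ (w ++ [ cl n ]))

base-⊇-pair : {i j k : ℕ} → 1 ≤ i → i < j → j ≤ k → cl i ∷ cl j ∷ [] ⊆ base k
base-⊇-pair {suc i} {suc j} _ (s≤s i<j) j<k =
  snoc⊆applyUpTo _ (snoc⊆applyUpTo _ (minimum _) i<j) j<k

base-⊇-triple : {i j l k : ℕ} → 1 ≤ i → i < j → j < l → l ≤ k →
                cl i ∷ cl j ∷ cl l ∷ [] ⊆ base k
base-⊇-triple {suc i} {suc j} {suc l} _ (s≤s i<j) (s≤s j<l) l<k =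
  snoc⊆applyUpTo _ (snoc⊆applyUpTo _ (snoc⊆applyUpTo _ (minimum _) i<j) j<l) l<k

afterCl-base-between : {m c n k : ℕ} (w : List Letter) → 1 ≤ m → m ≤ c → c < n → n ≤ k →
                       cl m ∷ w ++ [ cl n ] ⊆ afterCl c w (base k)
afterCl-base-between {m} {c} {n} {k} w 1≤m m≤c c<n n≤k with m≤n⇒m<n∨m≡n m≤c
... | inj₂ refl =
  ⊆-trans (⊆-reflexive (sym (afterCl-pair w c<n))) (afterCl⁺ _ w (base-⊇-pair 1≤m c<n n≤k))
... | inj₁ m<c = begin
  cl m ∷ w ++ [ cl n ]                   ⊆⟨ refl ∷ (cl c ∷ʳ ⊆-refl) ⟩
  cl m ∷ cl c ∷ w ++ [ cl n ]            ≡⟨ cong (cl m ∷_) (afterCl-pair w c<n) ⟨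
  cl m ∷ afterCl c w (cl c ∷ cl n ∷ [])  ≡⟨ afterCl-skip w (cl c ∷ cl n ∷ []) (<⇒≢ m<c) ⟨
  afterCl c w (cl m ∷ cl c ∷ cl n ∷ [])  ⊆⟨ afterCl⁺ c w (base-⊇-triple 1≤m m<c c<n n≤k) ⟩
  afterCl c w (base k)                   ∎
  where open ⊆-Reasoning

step-wrap : (N : ℕ → Nbhd) {a m n : ℕ} (s : State) → N a ≡ wrap m n →
            step N s a ≡ st (afterCl m [ iv a ] (p1 s)) (beforeCl n [ iv a ] (p2 s)) (d s ⊔ m)
step-wrap N {a} s eq with N a | eq
... | _ | refl = refl

p1-step-inserts : (N : ℕ → Nbhd) {a m n : ℕ} {s : State} → N a ≡ wrap m n → m < n →
                  cl m ∷ cl n ∷ [] ⊆ p1 s → cl m ∷ iv a ∷ cl n ∷ [] ⊆ p1 (step N s a)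
p1-step-inserts N {s = s} Na m<n τ rewrite step-wrap N s Na =
  subst (_⊆ _) (afterCl-pair [ iv _ ] m<n) (afterCl⁺ _ [ iv _ ] τ)

p2-step-inserts : (N : ℕ → Nbhd) {a m n : ℕ} {s : State} → N a ≡ wrap m n → m < n →
                  cl m ∷ cl n ∷ [] ⊆ p2 s → cl m ∷ iv a ∷ cl n ∷ [] ⊆ p2 (step N s a)
p2-step-inserts N {s = s} Na m<n τ rewrite step-wrap N s Na =
  subst (_⊆ _) (beforeCl-pair [ iv _ ] m<n) (beforeCl⁺ _ [ iv _ ] τ)

p1-step : (N : ℕ → Nbhd) (s : State) (b : ℕ) → p1 s ⊆ p1 (step N s b)
p1-step N s b with N b
... | wrap m n = afterCl-inflationary m _ (p1 s)
... | intv l r = beforeCl-inflationary l _ (p1 s)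

p2-step : (N : ℕ → Nbhd) (s : State) (b : ℕ) → p2 s ⊆ p2 (step N s b)
p2-step N s b with N b
... | wrap m n = beforeCl-inflationary n _ (p2 s)
... | intv l r = afterCl-inflationary r _ (p2 s)

d-step : (N : ℕ → Nbhd) (s : State) (b : ℕ) → d s ≤ d (step N s b)
d-step N s b with N b
... | wrap m n = m≤m⊔n (d s) m
... | intv l r = ≤-refl

d-step-< : (N : ℕ → Nbhd) {n : ℕ} (s : State) (b : ℕ) →
           (∀ {m′ n′} → N b ≡ wrap m′ n′ → m′ < n) → d s < n → d (step N s b) < n
d-step-< N s b bounded d<n with N b
... | wrap m′ n′ = ⊔-lub d<n (bounded refl)
... | intv l r   = d<n

p1-foldl-inserts : (N : ℕ → Nbhd) {a m n : ℕ} {s : State} (xs : List ℕ) → a ∈ xs →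
                   N a ≡ wrap m n → m < n → cl m ∷ cl n ∷ [] ⊆ p1 s →
                   cl m ∷ iv a ∷ cl n ∷ [] ⊆ p1 (foldl (step N) s xs)
p1-foldl-inserts N xs a∈xs Na m<n =
  foldl-establishes (step N) (λ s → _ ⊆ p1 s) (λ s → _ ⊆ p1 s) xs grows grows
    (p1-step-inserts N Na m<n) a∈xs
  where
  grows : {ys : List Letter} → Preserves (step N) (λ s → ys ⊆ p1 s)
  grows b τ = ⊆-trans τ (p1-step N _ b)

p2-foldl-inserts : (N : ℕ → Nbhd) {a m n : ℕ} {s : State} (xs : List ℕ) → a ∈ xs →
                   N a ≡ wrap m n → m < n → cl m ∷ cl n ∷ [] ⊆ p2 s →
                   cl m ∷ iv a ∷ cl n ∷ [] ⊆ p2 (foldl (step N) s xs)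
p2-foldl-inserts N xs a∈xs Na m<n =
  foldl-establishes (step N) (λ s → _ ⊆ p2 s) (λ s → _ ⊆ p2 s) xs grows grows
    (p2-step-inserts N Na m<n) a∈xs
  where
  grows : {ys : List Letter} → Preserves (step N) (λ s → ys ⊆ p2 s)
  grows b τ = ⊆-trans τ (p2-step N _ b)

d-foldl-≥ : (N : ℕ → Nbhd) {a m n : ℕ} {s : State} (xs : List ℕ) → a ∈ xs →
            N a ≡ wrap m n → m ≤ d (foldl (step N) s xs)
d-foldl-≥ N {m = m} xs a∈xs Na =
  foldl-establishes (step N) (λ _ → ⊤) (λ s → m ≤ d s) xs
    (λ _ _ → tt) (λ b m≤d → ≤-trans m≤d (d-step N _ b))
    (λ {t} _ → subst (λ u → m ≤ d u) (sym (step-wrap N t Na)) (m≤n⊔m (d t) m)) a∈xs tt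

d-foldl-< : (N : ℕ → Nbhd) {n : ℕ} {s : State} (xs : List ℕ) →
            (∀ b {m′ n′} → b ∈ xs → N b ≡ wrap m′ n′ → m′ < n) → d s < n →
            d (foldl (step N) s xs) < n
d-foldl-< N {n} xs bounded =
  foldl-preserves (step N) (λ s → d s < n) xs (λ b b∈xs → d-step-< N _ b (bounded b b∈xs))

restrictA-keeps : (N : ℕ → Nbhd) {a : ℕ} (xs : List Letter) →
                  isA N a ≡ true → iv a ∈ xs → iv a ∈ restrictA N xs
restrictA-keeps N (cl x ∷ xs) isAa (there a∈xs) = restrictA-keeps N xs isAa a∈xs
restrictA-keeps N (iv x ∷ xs) isAa (here refl) rewrite isAa = here refl
restrictA-keeps N (iv x ∷ xs) isAa (there a∈xs) with isA N x
... | true  = there (restrictA-keeps N xs isAa a∈xs)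
... | false = restrictA-keeps N xs isAa a∈xs

isA-wrap : (N : ℕ → Nbhd) {a m n : ℕ} → N a ≡ wrap m n → isA N a ≡ true
isA-wrap N {a} eq with N a | eq
... | _ | refl = refl

lemma1 : (k : ℕ) (N : ℕ → Nbhd) (I : List ℕ)
    → Unique I
    → (∀ a → a ∈ I → WellFormed k (N a))
    → (∀ a b m n l r → a ∈ I → b ∈ I → N a ≡ wrap m n → N b ≡ intv l r → m < l ⊎ r < n)
    → (∀ a b m n m′ n′ → a ∈ I → b ∈ I → N a ≡ wrap m n → N b ≡ wrap m′ n′ → m′ < n × m < n′)
    → ∀ a m n → a ∈ I → N a ≡ wrap m n
    → ((cl m ∷ iv a ∷ cl n ∷ []) ⊆ P1 k N I)
    × ((cl m ∷ iv a ∷ cl n ∷ []) ⊆ P2 k N I)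
    × ((cl m ∷ iv a ∷ cl n ∷ []) ⊆ P3 k N I)
lemma1 k N I _ wf _ wrap-wrap a m n a∈I Na with subst (WellFormed k) Na (wf a a∈I)
... | 1≤m , 1+m<n , n≤k = in-P1 , in-P2 , in-P3
  where
  m<n : m < n
  m<n = <-trans (n<1+n m) 1+m<n
  in-P1 : cl m ∷ iv a ∷ cl n ∷ [] ⊆ P1 k N I
  in-P1 = p1-foldl-inserts N I a∈I Na m<n (base-⊇-pair 1≤m m<n n≤k)
  in-P2 : cl m ∷ iv a ∷ cl n ∷ [] ⊆ P2 k N I
  in-P2 = p2-foldl-inserts N I a∈I Na m<n (base-⊇-pair 1≤m m<n n≤k)
  m≤d : m ≤ d (run k N I)
  m≤d = d-foldl-≥ N I a∈I Na
  d<n : d (run k N I) < n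
  d<n = d-foldl-< N I (λ b b∈I Nb → proj₁ (wrap-wrap a b m n _ _ a∈I b∈I Na Nb))
                    (<-trans (s≤s 1≤m) 1+m<n)
  a∈P1|A : iv a ∈ reverse (restrictA N (P1 k N I))
  a∈P1|A = reverse⁺ (restrictA-keeps N _ (isA-wrap N Na) (to∈ (∷ˡ⁻ in-P1)))
  in-P3 : cl m ∷ iv a ∷ cl n ∷ [] ⊆ P3 k N I
  in-P3 = ⊆-trans (refl ∷ ++⁺ (from∈ a∈P1|A) ⊆-refl)
                  (afterCl-base-between _ 1≤m m≤d d<n n≤k)
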